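{- Let $P\subseteq\mathbb{R}^d$ be a rational polytope and $Q\subseteq\mathbb{R}^d$ a lattice polytope with $Q=Q_1+\dots+Q_s$ (Minkowski sum), where $Q_1,\dots,Q_s$ are lattice polytopes such that each pair $(Q_i,P)$ is convex-normal. Then $(Q,P)$ is convex-normal.
   Context: A lattice (resp. rational) polytope is the convex hull of finitely many points of $\mathbb{Z}^d$ (resp. $\mathbb{Q}^d$). For a polytope $Q$ with vertex set $\mathrm{ver}(Q)$ set $G(Q):=\bigcup_{v\in\mathrm{ver}(Q)}\big((v+\mathbb{Z}^d)\cap Q\big)$. A pair of polytopes $(Q,P)$ is convex-normal if $Q+P=G(Q)+P$ (Minkowski sums).
   Formalization: All points, including the vertices and the points of Q+P, G(Q)+P and $Q_1+\dots+Q_s$, are taken in ℚ^d instead of ℝ^d. -}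

module Defs where

open import Data.Nat using (ℕ; zero; suc)
open import Data.Fin using (Fin; zero; suc)
open import Data.Rational using (ℚ; 0ℚ; 1ℚ; _+_; _*_; _-_; _≤_; _<_; ↧ₙ_)
open import Data.Product using (Σ; _×_)
open import Relation.Binary.PropositionalEquality using (_≡_)

Point : ℕ → Set
Point d = Fin d → ℚ

_≈ₚ_ : ∀ {d} → Point d → Point d → Set
x ≈ₚ y = ∀ i → x i ≡ y i

_+ₚ_ : ∀ {d} → Point d → Point d → Point d
(x +ₚ y) i = x i + y i

_-ₚ_ : ∀ {d} → Point d → Point d → Point d
(x -ₚ y) i = x i - y i

_·ₚ_ : ∀ {d} → ℚ → Point d → Point d
(t ·ₚ x) i = t * x i

0ₚ : ∀ {d} → Point d
0ₚ i = 0ℚ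

sumFin : ∀ {n} → (Fin n → ℚ) → ℚ
sumFin {zero}  f = 0ℚ
sumFin {suc n} f = f zero + sumFin (λ j → f (suc j))

IsIntegral : ∀ {d} → Point d → Set
IsIntegral x = ∀ i → ↧ₙ (x i) ≡ 1

-- A polytope = convex hull of finitely many points of ℚ^d (so a rational polytope).
record Polytope (d : ℕ) : Set where
  field
    n   : ℕ
    gen : Fin n → Point d
open Polytope public

PSet : ℕ → Set₁
PSet d = Point d → Set

⟦_⟧ : ∀ {d} → Polytope d → PSet d
⟦ Q ⟧ x = Σ (Fin (n Q) → ℚ) λ c →
            (∀ j → 0ℚ ≤ c j) × (sumFin c ≡ 1ℚ) ×
            (∀ i → x i ≡ sumFin (λ j → c j * gen Q j i))

IsLattice : ∀ {d} → Polytope d → Set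
IsLattice Q = ∀ j → IsIntegral (gen Q j)

IsVertex : ∀ {d} → Polytope d → Point d → Set
IsVertex Q v = ⟦ Q ⟧ v ×
  (∀ a b t → ⟦ Q ⟧ a → ⟦ Q ⟧ b → 0ℚ < t → t < 1ℚ →
     v ≈ₚ ((t ·ₚ a) +ₚ ((1ℚ - t) ·ₚ b)) → a ≈ₚ v)

G : ∀ {d} → Polytope d → PSet d
G Q x = ⟦ Q ⟧ x × Σ (Point _) λ v → IsVertex Q v × IsIntegral (x -ₚ v)

_⊕_ : ∀ {d} → PSet d → PSet d → PSet d
(A ⊕ B) x = Σ (Point _) λ a → Σ (Point _) λ b → A a × B b × (x ≈ₚ (a +ₚ b))

MinkSum : ∀ {d s} → (Fin s → PSet d) → PSet d
MinkSum {s = zero}  A x = x ≈ₚ 0ₚ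
MinkSum {s = suc s} A = A zero ⊕ MinkSum (λ i → A (suc i))

_≐_ : ∀ {d} → PSet d → PSet d → Set
A ≐ B = (∀ x → A x → B x) × (∀ x → B x → A x)

ConvexNormal : ∀ {d} → Polytope d → Polytope d → Set
ConvexNormal Q P = (⟦ Q ⟧ ⊕ ⟦ P ⟧) ≐ (G Q ⊕ ⟦ P ⟧)

{-# OPTIONS --safe #-}
module Submission where

-- For a lattice polytope R, G(R) is exactly the set of lattice points of R: every vertex of R
-- is a lattice point, and R has a vertex, namely its lexicographically largest generator, so
-- every lattice point of R differs from a vertex by a lattice vector. Convex-normality of
-- (Qᵢ, P) therefore says Qᵢ + P ⊆ (Qᵢ ∩ ℤᵈ) + P. Such inclusions can be applied one summand at
-- a time, giving Q + P ⊆ (Q₁ ∩ ℤᵈ) + ⋯ + (Qₛ ∩ ℤᵈ) + P ⊆ (Q ∩ ℤᵈ) + P = G(Q) + P.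

open import Defs
open import Data.Nat using (ℕ)
open import Data.Fin using (Fin)

open import Data.Empty using (⊥-elim)
open import Data.Nat using (zero; suc)
open import Data.Fin as Fin using (zero; suc)
import Data.Integer as ℤ
import Data.Integer.GCD as ℤ
import Data.Integer.Properties as ℤ
open import Data.List using (_∷_; [])
open import Data.Product using (Σ; _×_; _,_; proj₁; proj₂; map; map₁)
open import Data.Rational
  using (ℚ; mkℚ; 0ℚ; 1ℚ; ½; _+_; _*_; _-_; -_; _≤_; _<_; _<?_; ↥_; ↧_; ↧ₙ_; _/_; positive; nonNegative)
open import Data.Rational.Properties
open import Algebra.Properties.Group +-0-group using (identityʳ-unique; x∙y⁻¹≈ε⇒x≈y)
open import Data.Sum using (_⊎_; inj₁; inj₂)
open import Data.Unit using (tt)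
open import Data.Vec.Functional using (head; tail)
open import Function using (_∘_; id)
open import Level using (0ℓ)
open import Relation.Binary.Definitions using (tri<; tri≈; tri>)
open import Relation.Binary.PropositionalEquality
open import Relation.Nullary using (yes; no)
open import Relation.Nullary.Decidable using (toWitness; dec⇒maybe)
open import Relation.Unary using (_⊆′_; _∩_)
open import Tactic.RingSolver using (solve; solve-∀)
import Tactic.RingSolver.Core.AlmostCommutativeRing as ACR

ℚ-ring : ACR.AlmostCommutativeRing 0ℓ 0ℓ
ℚ-ring = ACR.fromCommutativeRing +-*-commutativeRing (λ p → dec⇒maybe (0ℚ ≟ p))

private
  variable
    d m s : ℕ
    p q : ℚ

*-nonneg : 0ℚ ≤ p → 0ℚ ≤ q → 0ℚ ≤ p * q
*-nonneg {p} {q} 0≤p 0≤q =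
  nonNegative⁻¹ _ {{nonNeg*nonNeg⇒nonNeg p {{nonNegative 0≤p}} q {{nonNegative 0≤q}}}}

p≤q⇒0≤q-p : p ≤ q → 0ℚ ≤ q - p
p≤q⇒0≤q-p {p} {q} p≤q = subst (_≤ q - p) (+-inverseʳ p) (+-monoˡ-≤ (- p) p≤q)

0≤q-p⇒p≤q : ∀ {p q} → 0ℚ ≤ q - p → p ≤ q
0≤q-p⇒p≤q {p} {q} 0≤q-p = subst₂ _≤_ (+-identityˡ p) q-p+p≡q (+-monoˡ-≤ p 0≤q-p)
  where
  q-p+p≡q : (q - p) + p ≡ q
  q-p+p≡q = solve (q ∷ p ∷ []) ℚ-ring

pos*q≡0⇒q≡0 : 0ℚ < p → p * q ≡ 0ℚ → q ≡ 0ℚ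
pos*q≡0⇒q≡0 {p} {q} 0<p pq≡0 = ≤-antisym
  (*-cancelˡ-≤-pos p (≤-reflexive (trans pq≡0 (sym (*-zeroʳ p)))))
  (*-cancelˡ-≤-pos p (≤-reflexive (trans (*-zeroʳ p) (sym pq≡0))))
  where instance _ = positive 0<p

nonneg⇒≡0⊎pos : 0ℚ ≤ p → p ≡ 0ℚ ⊎ 0ℚ < p
nonneg⇒≡0⊎pos {p} 0≤p with 0ℚ <? p
... | yes 0<p = inj₂ 0<p
... | no 0≮p = inj₁ (≤-antisym (≮⇒≥ 0≮p) 0≤p)

½<1 : ½ < 1ℚ
½<1 = toWitness {a? = ½ <? 1ℚ} tt

IsInteger : ℚ → Set
IsInteger p = ↧ₙ p ≡ 1

IsInteger-/1 : ∀ i → IsInteger (i / 1)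
IsInteger-/1 i = cong ℤ.∣_∣ (begin
  ↧ (i / 1)                 ≡⟨ ℤ.*-identityʳ _ ⟨
  ↧ (i / 1) ℤ.* ℤ.1ℤ        ≡⟨ cong (↧ (i / 1) ℤ.*_) (ℤ.gcd-zeroʳ i) ⟨
  ↧ (i / 1) ℤ.* ℤ.gcd i ℤ.1ℤ ≡⟨ ↧-/ i 1 ⟩
  ℤ.1ℤ                      ∎)
  where open ≡-Reasoning

IsInteger-+ : ∀ p q → IsInteger p → IsInteger q → IsInteger (p + q)
IsInteger-+ p@(mkℚ _ _ _) q@(mkℚ _ _ _) refl refl = IsInteger-/1 (↥ p ℤ.* ↧ q ℤ.+ ↥ q ℤ.* ↧ p)

IsInteger-neg : ∀ p → IsInteger p → IsInteger (- p)
IsInteger-neg p = trans (cong ℤ.∣_∣ (↧-neg p))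

IsIntegral-resp-≈ₚ : ∀ {x y : Point d} → x ≈ₚ y → IsIntegral y → IsIntegral x
IsIntegral-resp-≈ₚ x≈y y∈ℤ i = subst IsInteger (sym (x≈y i)) (y∈ℤ i)

IsIntegral-+ₚ : ∀ (x y : Point d) → IsIntegral x → IsIntegral y → IsIntegral (x +ₚ y)
IsIntegral-+ₚ x y x∈ℤ y∈ℤ i = IsInteger-+ (x i) (y i) (x∈ℤ i) (y∈ℤ i)

IsIntegral-diff : ∀ (x y : Point d) → IsIntegral x → IsIntegral y → IsIntegral (x -ₚ y)
IsIntegral-diff x y x∈ℤ y∈ℤ i = IsInteger-+ (x i) (- y i) (x∈ℤ i) (IsInteger-neg (y i) (y∈ℤ i))

sumFin-cong : ∀ {f g : Fin m → ℚ} → (∀ j → f j ≡ g j) → sumFin f ≡ sumFin g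
sumFin-cong {zero}  f≗g = refl
sumFin-cong {suc m} f≗g = cong₂ _+_ (f≗g zero) (sumFin-cong (λ j → f≗g (suc j)))

sumFin-linear : ∀ α β (f g : Fin m → ℚ) →
  sumFin (λ j → α * f j + β * g j) ≡ α * sumFin f + β * sumFin g
sumFin-linear {zero}  α β f g = solve (α ∷ β ∷ []) ℚ-ring
sumFin-linear {suc m} α β f g = begin
  (α * f zero + β * g zero) + sumFin (λ j → α * tail f j + β * tail g j)
    ≡⟨ cong (α * f zero + β * g zero +_) (sumFin-linear α β (tail f) (tail g)) ⟩
  (α * f zero + β * g zero) + (α * sumFin (tail f) + β * sumFin (tail g))
    ≡⟨ regroup α β (f zero) (g zero) (sumFin (tail f)) (sumFin (tail g)) ⟩
  α * (f zero + sumFin (tail f)) + β * (g zero + sumFin (tail g)) ∎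
  where
  open ≡-Reasoning
  regroup : ∀ a b x y X Y → (a * x + b * y) + (a * X + b * Y) ≡ a * (x + X) + b * (y + Y)
  regroup = solve-∀ ℚ-ring

sumFin-0* : ∀ (f : Fin m → ℚ) → sumFin (λ j → 0ℚ * f j) ≡ 0ℚ
sumFin-0* {zero}  f = refl
sumFin-0* {suc m} f = cong₂ _+_ (*-zeroˡ (f zero)) (sumFin-0* (tail f))

δ : Fin m → Fin m → ℚ
δ zero    zero    = 1ℚ
δ zero    (suc j) = 0ℚ
δ (suc k) zero    = 0ℚ
δ (suc k) (suc j) = δ k j

δ-nonneg : ∀ (k j : Fin m) → 0ℚ ≤ δ k j
δ-nonneg zero    zero    = nonNegative⁻¹ 1ℚ
δ-nonneg zero    (suc j) = ≤-refl
δ-nonneg (suc k) zero    = ≤-refl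
δ-nonneg (suc k) (suc j) = δ-nonneg k j

δ-diag : ∀ (k : Fin m) → δ k k ≡ 1ℚ
δ-diag zero    = refl
δ-diag (suc k) = δ-diag k

δ-offDiag : ∀ (k j : Fin m) → k ≢ j → δ k j ≡ 0ℚ
δ-offDiag zero    zero    k≢j = ⊥-elim (k≢j refl)
δ-offDiag zero    (suc j) k≢j = refl
δ-offDiag (suc k) zero    k≢j = refl
δ-offDiag (suc k) (suc j) k≢j = δ-offDiag k j (k≢j ∘ cong suc)

sumFin-δ* : ∀ (k : Fin m) (f : Fin m → ℚ) → sumFin (λ j → δ k j * f j) ≡ f k
sumFin-δ* {suc m} zero f =
  trans (cong₂ _+_ (*-identityˡ (f zero)) (sumFin-0* (tail f))) (+-identityʳ (f zero))
sumFin-δ* {suc m} (suc k) f =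
  trans (cong₂ _+_ (*-zeroˡ (f zero)) (sumFin-δ* k (tail f))) (+-identityˡ (f (suc k)))

sumFin-δ : ∀ (k : Fin m) → sumFin (δ k) ≡ 1ℚ
sumFin-δ k = trans (sumFin-cong (λ j → sym (*-identityʳ (δ k j)))) (sumFin-δ* k (λ _ → 1ℚ))

sumFin-nonneg : ∀ (f : Fin m → ℚ) → (∀ j → 0ℚ ≤ f j) → 0ℚ ≤ sumFin f
sumFin-nonneg {zero}  f f≥0 = ≤-refl
sumFin-nonneg {suc m} f f≥0 = +-mono-≤ (f≥0 zero) (sumFin-nonneg (tail f) (f≥0 ∘ suc))

term≤sumFin : ∀ (f : Fin m → ℚ) → (∀ j → 0ℚ ≤ f j) → ∀ k → f k ≤ sumFin f
term≤sumFin f f≥0 zero = begin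
  f zero                       ≡⟨ +-identityʳ (f zero) ⟨
  f zero + 0ℚ                  ≤⟨ +-monoʳ-≤ (f zero) (sumFin-nonneg (tail f) (f≥0 ∘ suc)) ⟩
  f zero + sumFin (tail f)     ∎
  where open ≤-Reasoning
term≤sumFin f f≥0 (suc k) = begin
  f (suc k)                    ≤⟨ term≤sumFin (tail f) (f≥0 ∘ suc) k ⟩
  sumFin (tail f)              ≡⟨ +-identityˡ (sumFin (tail f)) ⟨
  0ℚ + sumFin (tail f)         ≤⟨ +-monoˡ-≤ (sumFin (tail f)) (f≥0 zero) ⟩
  f zero + sumFin (tail f)     ∎
  where open ≤-Reasoning

sumFin≡0⇒terms≡0 : ∀ (f : Fin m → ℚ) → (∀ j → 0ℚ ≤ f j) → sumFin f ≡ 0ℚ → ∀ k → f k ≡ 0ℚ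
sumFin≡0⇒terms≡0 f f≥0 Σf≡0 k = ≤-antisym (subst (f k ≤_) Σf≡0 (term≤sumFin f f≥0 k)) (f≥0 k)

sumFin-pos⇒term-pos : ∀ (f : Fin m → ℚ) → 0ℚ < sumFin f → Σ (Fin m) λ k → 0ℚ < f k
sumFin-pos⇒term-pos {zero}  f 0<0 = ⊥-elim (<-irrefl refl 0<0)
sumFin-pos⇒term-pos {suc m} f 0<Σf with 0ℚ <? f zero
... | yes 0<f₀ = zero , 0<f₀
... | no 0≮f₀  = map suc id (sumFin-pos⇒term-pos (tail f) (<-≤-trans 0<Σf Σf≤Σtail))
  where
  open ≤-Reasoning
  Σf≤Σtail : sumFin f ≤ sumFin (tail f)
  Σf≤Σtail = begin
    f zero + sumFin (tail f) ≤⟨ +-monoˡ-≤ (sumFin (tail f)) (≮⇒≥ 0≮f₀) ⟩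
    0ℚ + sumFin (tail f)     ≡⟨ +-identityˡ (sumFin (tail f)) ⟩
    sumFin (tail f)          ∎

positive-weight : ∀ (c : Fin m → ℚ) → sumFin c ≡ 1ℚ → Σ (Fin m) λ k → 0ℚ < c k
positive-weight c Σc≡1 = sumFin-pos⇒term-pos c (subst (0ℚ <_) (sym Σc≡1) (positive⁻¹ 1ℚ))

sumFin-deviation : ∀ (c y : Fin m → ℚ) w → sumFin c ≡ 1ℚ →
  sumFin (λ j → c j * (w - y j)) ≡ w - sumFin (λ j → c j * y j)
sumFin-deviation c y w Σc≡1 = begin
  sumFin (λ j → c j * (w - y j))                ≡⟨ sumFin-cong (λ j → expand (c j) w (y j)) ⟩
  sumFin (λ j → w * c j + (- 1ℚ) * (c j * y j)) ≡⟨ sumFin-linear w (- 1ℚ) c (λ j → c j * y j) ⟩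
  w * sumFin c + (- 1ℚ) * S                     ≡⟨ cong (λ z → w * z + (- 1ℚ) * S) Σc≡1 ⟩
  w * 1ℚ + (- 1ℚ) * S                           ≡⟨ collapse w S ⟩
  w - S                                         ∎
  where
  open ≡-Reasoning
  S = sumFin (λ j → c j * y j)
  expand : ∀ a w y → a * (w - y) ≡ w * a + (- 1ℚ) * (a * y)
  expand = solve-∀ ℚ-ring
  collapse : ∀ w S → w * 1ℚ + (- 1ℚ) * S ≡ w - S
  collapse = solve-∀ ℚ-ring

deviation-nonneg : ∀ {c y : Fin m → ℚ} {w} → (∀ j → 0ℚ ≤ c j) →
  (∀ j → 0ℚ < c j → y j ≤ w) → ∀ j → 0ℚ ≤ c j * (w - y j)
deviation-nonneg {c = c} {y} {w} c≥0 y≤w j with nonneg⇒≡0⊎pos (c≥0 j)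
... | inj₁ cⱼ≡0 = ≤-reflexive (sym (trans (cong (_* (w - y j)) cⱼ≡0) (*-zeroˡ (w - y j))))
... | inj₂ cⱼ>0 = *-nonneg (c≥0 j) (p≤q⇒0≤q-p (y≤w j cⱼ>0))

convexSum≤ : ∀ {c y : Fin m → ℚ} {w} → (∀ j → 0ℚ ≤ c j) → sumFin c ≡ 1ℚ →
  (∀ j → 0ℚ < c j → y j ≤ w) → sumFin (λ j → c j * y j) ≤ w
convexSum≤ {c = c} {y} {w} c≥0 Σc≡1 y≤w = 0≤q-p⇒p≤q
  (subst (0ℚ ≤_) (sumFin-deviation c y w Σc≡1) (sumFin-nonneg _ (deviation-nonneg c≥0 y≤w)))

convexSum≡⇒supported≡ : ∀ {c y : Fin m → ℚ} {w} → (∀ j → 0ℚ ≤ c j) → sumFin c ≡ 1ℚ →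
  (∀ j → 0ℚ < c j → y j ≤ w) → sumFin (λ j → c j * y j) ≡ w → ∀ j → 0ℚ < c j → y j ≡ w
convexSum≡⇒supported≡ {c = c} {y} {w} c≥0 Σc≡1 y≤w S≡w j cⱼ>0 =
  sym (x∙y⁻¹≈ε⇒x≈y w (y j) (pos*q≡0⇒q≡0 cⱼ>0 deviationⱼ≡0))
  where
  Σdeviation≡0 : sumFin (λ j → c j * (w - y j)) ≡ 0ℚ
  Σdeviation≡0 = trans (sumFin-deviation c y w Σc≡1) (trans (cong (λ S → w - S) S≡w) (+-inverseʳ w))
  deviationⱼ≡0 : c j * (w - y j) ≡ 0ℚ
  deviationⱼ≡0 = sumFin≡0⇒terms≡0 _ (deviation-nonneg c≥0 y≤w) Σdeviation≡0 j

infix 4 _≤ₗₑₓ_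

data _≤ₗₑₓ_ : Point d → Point d → Set where
  ≤ₗₑₓ-[] : {x y : Point zero} → x ≤ₗₑₓ y
  <-head  : {x y : Point (suc d)} → head x < head y → x ≤ₗₑₓ y
  ≡-head  : {x y : Point (suc d)} → head x ≡ head y → tail x ≤ₗₑₓ tail y → x ≤ₗₑₓ y

≤ₗₑₓ-refl : ∀ (x : Point d) → x ≤ₗₑₓ x
≤ₗₑₓ-refl {zero}  x = ≤ₗₑₓ-[]
≤ₗₑₓ-refl {suc d} x = ≡-head refl (≤ₗₑₓ-refl (tail x))

≤ₗₑₓ-trans : ∀ {x y z : Point d} → x ≤ₗₑₓ y → y ≤ₗₑₓ z → x ≤ₗₑₓ z
≤ₗₑₓ-trans ≤ₗₑₓ-[]               ≤ₗₑₓ-[]               = ≤ₗₑₓ-[]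
≤ₗₑₓ-trans (<-head x₀<y₀)         (<-head y₀<z₀)         = <-head (<-trans x₀<y₀ y₀<z₀)
≤ₗₑₓ-trans (<-head x₀<y₀)         (≡-head y₀≡z₀ _)       = <-head (subst (_ <_) y₀≡z₀ x₀<y₀)
≤ₗₑₓ-trans (≡-head x₀≡y₀ _)       (<-head y₀<z₀)         = <-head (subst (_< _) (sym x₀≡y₀) y₀<z₀)
≤ₗₑₓ-trans (≡-head x₀≡y₀ x′≤y′)   (≡-head y₀≡z₀ y′≤z′)   = ≡-head (trans x₀≡y₀ y₀≡z₀) (≤ₗₑₓ-trans x′≤y′ y′≤z′)

≤ₗₑₓ-total : ∀ (x y : Point d) → x ≤ₗₑₓ y ⊎ y ≤ₗₑₓ x
≤ₗₑₓ-total {zero}  x y = inj₁ ≤ₗₑₓ-[]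
≤ₗₑₓ-total {suc d} x y with <-cmp (head x) (head y) | ≤ₗₑₓ-total (tail x) (tail y)
... | tri< x₀<y₀ _ _ | _          = inj₁ (<-head x₀<y₀)
... | tri> _ _ y₀<x₀ | _          = inj₂ (<-head y₀<x₀)
... | tri≈ _ x₀≡y₀ _ | inj₁ x′≤y′ = inj₁ (≡-head x₀≡y₀ x′≤y′)
... | tri≈ _ x₀≡y₀ _ | inj₂ y′≤x′ = inj₂ (≡-head (sym x₀≡y₀) y′≤x′)

≤ₗₑₓ-head : ∀ {x y : Point (suc d)} → x ≤ₗₑₓ y → head x ≤ head y
≤ₗₑₓ-head (<-head x₀<y₀)   = <⇒≤ x₀<y₀
≤ₗₑₓ-head (≡-head x₀≡y₀ _) = ≤-reflexive x₀≡y₀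

≤ₗₑₓ-tail : ∀ {x y : Point (suc d)} → x ≤ₗₑₓ y → head x ≡ head y → tail x ≤ₗₑₓ tail y
≤ₗₑₓ-tail (<-head x₀<y₀)   x₀≡y₀ = ⊥-elim (<-irrefl x₀≡y₀ x₀<y₀)
≤ₗₑₓ-tail (≡-head _ x′≤y′) _     = x′≤y′

≤ₗₑₓ-respˡ-≈ₚ : ∀ {x y w : Point d} → x ≈ₚ y → y ≤ₗₑₓ w → x ≤ₗₑₓ w
≤ₗₑₓ-respˡ-≈ₚ x≈y ≤ₗₑₓ-[]             = ≤ₗₑₓ-[]
≤ₗₑₓ-respˡ-≈ₚ x≈y (<-head y₀<w₀)       = <-head (subst (_< _) (sym (x≈y zero)) y₀<w₀)
≤ₗₑₓ-respˡ-≈ₚ x≈y (≡-head y₀≡w₀ y′≤w′) = ≡-head (trans (x≈y zero) y₀≡w₀) (≤ₗₑₓ-respˡ-≈ₚ (x≈y ∘ suc) y′≤w′)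

lexMaximum : ∀ (g : Fin m → Point d) → Fin m → Σ (Fin m) λ k → ∀ j → g j ≤ₗₑₓ g k
lexMaximum {suc zero}    g _ = zero , λ { zero → ≤ₗₑₓ-refl (g zero) }
lexMaximum {suc (suc m)} g _ with lexMaximum (tail g) zero
... | k , g′≤gₖ with ≤ₗₑₓ-total (g zero) (tail g k)
...   | inj₁ g₀≤gₖ = suc k , λ { zero → g₀≤gₖ ; (suc j) → g′≤gₖ j }
...   | inj₂ gₖ≤g₀ = zero  , λ { zero → ≤ₗₑₓ-refl (g zero) ; (suc j) → ≤ₗₑₓ-trans (g′≤gₖ j) gₖ≤g₀ }

combination : (Fin m → ℚ) → (Fin m → Point d) → Point d
combination c x i = sumFin (λ j → c j * x j i)

module _ {c : Fin m → ℚ} (c≥0 : ∀ j → 0ℚ ≤ c j) (Σc≡1 : sumFin c ≡ 1ℚ) where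

  supportedTails-≤ₗₑₓ : ∀ {x : Fin m → Point (suc d)} {w} → (∀ j → 0ℚ < c j → x j ≤ₗₑₓ w) →
    head (combination c x) ≡ head w → ∀ j → 0ℚ < c j → tail (x j) ≤ₗₑₓ tail w
  supportedTails-≤ₗₑₓ x≤w S₀≡w₀ j cⱼ>0 = ≤ₗₑₓ-tail (x≤w j cⱼ>0)
    (convexSum≡⇒supported≡ c≥0 Σc≡1 (λ j cⱼ>0 → ≤ₗₑₓ-head (x≤w j cⱼ>0)) S₀≡w₀ j cⱼ>0)

  combination-≤ₗₑₓ : ∀ {x : Fin m → Point d} {w} → (∀ j → 0ℚ < c j → x j ≤ₗₑₓ w) →
    combination c x ≤ₗₑₓ w
  combination-≤ₗₑₓ {zero}          x≤w = ≤ₗₑₓ-[]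
  combination-≤ₗₑₓ {suc d} {x} {w} x≤w with <-cmp (head (combination c x)) (head w)
  ... | tri< S₀<w₀ _ _ = <-head S₀<w₀
  ... | tri≈ _ S₀≡w₀ _ = ≡-head S₀≡w₀ (combination-≤ₗₑₓ (supportedTails-≤ₗₑₓ x≤w S₀≡w₀))
  ... | tri> _ _ w₀<S₀ =
    ⊥-elim (<-irrefl refl (<-≤-trans w₀<S₀ (convexSum≤ c≥0 Σc≡1 (λ j cⱼ>0 → ≤ₗₑₓ-head (x≤w j cⱼ>0)))))

  combination≡lexBound⇒supported≡ : ∀ {x : Fin m → Point d} {w} → (∀ j → 0ℚ < c j → x j ≤ₗₑₓ w) →
    combination c x ≈ₚ w → ∀ j → 0ℚ < c j → x j ≈ₚ w
  combination≡lexBound⇒supported≡ {suc d} x≤w S≈w j cⱼ>0 zero =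
    convexSum≡⇒supported≡ c≥0 Σc≡1 (λ j cⱼ>0 → ≤ₗₑₓ-head (x≤w j cⱼ>0)) (S≈w zero) j cⱼ>0
  combination≡lexBound⇒supported≡ {suc d} x≤w S≈w j cⱼ>0 (suc i) =
    combination≡lexBound⇒supported≡ (supportedTails-≤ₗₑₓ x≤w (S≈w zero)) (S≈w ∘ suc) j cⱼ>0 i

lexBound-extreme : ∀ {a b w : Point d} {t} → 0ℚ < t → t < 1ℚ → a ≤ₗₑₓ w → b ≤ₗₑₓ w →
  w ≈ₚ ((t ·ₚ a) +ₚ ((1ℚ - t) ·ₚ b)) → a ≈ₚ w
lexBound-extreme {a = a} {b} {w} {t} 0<t t<1 a≤w b≤w w≈ =
  combination≡lexBound⇒supported≡ c≥0 Σc≡1 x≤w (λ i → sym (trans (w≈ i) (padding i))) zero 0<t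
  where
  c : Fin 2 → ℚ
  c = λ { zero → t ; (suc zero) → 1ℚ - t }
  x : Fin 2 → Point _
  x = λ { zero → a ; (suc zero) → b }
  c≥0 : ∀ j → 0ℚ ≤ c j
  c≥0 = λ { zero → <⇒≤ 0<t ; (suc zero) → p≤q⇒0≤q-p (<⇒≤ t<1) }
  Σc≡1 : sumFin c ≡ 1ℚ
  Σc≡1 = complement t
    where
    complement : ∀ t → t + ((1ℚ - t) + 0ℚ) ≡ 1ℚ
    complement = solve-∀ ℚ-ring
  x≤w : ∀ j → 0ℚ < c j → x j ≤ₗₑₓ w
  x≤w = λ { zero _ → a≤w ; (suc zero) _ → b≤w }
  padding : ∀ i → t * a i + (1ℚ - t) * b i ≡ combination c x i
  padding i = cong (t * a i +_) (sym (+-identityʳ ((1ℚ - t) * b i)))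

generator-∈ : ∀ (R : Polytope d) k → ⟦ R ⟧ (gen R k)
generator-∈ R k = δ k , δ-nonneg k , sumFin-δ k , λ i → sym (sumFin-δ* k (λ j → gen R j i))

hull-≤ₗₑₓ : ∀ (R : Polytope d) {w} → (∀ j → gen R j ≤ₗₑₓ w) → ∀ {x} → ⟦ R ⟧ x → x ≤ₗₑₓ w
hull-≤ₗₑₓ R g≤w (c , c≥0 , Σc≡1 , x≡) = ≤ₗₑₓ-respˡ-≈ₚ x≡ (combination-≤ₗₑₓ c≥0 Σc≡1 (λ j _ → g≤w j))

lexMaxGenerator-isVertex : ∀ (R : Polytope d) {k} → (∀ j → gen R j ≤ₗₑₓ gen R k) → IsVertex R (gen R k)
lexMaxGenerator-isVertex R {k} g≤gₖ = generator-∈ R k , λ a b t a∈R b∈R 0<t t<1 gₖ≈ →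
  lexBound-extreme 0<t t<1 (hull-≤ₗₑₓ R g≤gₖ a∈R) (hull-≤ₗₑₓ R g≤gₖ b∈R) gₖ≈

lattice-integralVertex : ∀ (R : Polytope d) → IsLattice R → ∀ {x} → ⟦ R ⟧ x →
  Σ (Point d) λ w → IsVertex R w × IsIntegral w
lattice-integralVertex R lattice (c , _ , Σc≡1 , _)
  with lexMaximum (gen R) (proj₁ (positive-weight c Σc≡1))
... | k , g≤gₖ = gen R k , lexMaxGenerator-isVertex R g≤gₖ , lattice k

towardsGenerator-∈ : ∀ (R : Polytope d) {v} → ((c , _ , _ , _) : ⟦ R ⟧ v) → ∀ k β →
  (∀ j → 0ℚ ≤ (1ℚ - β) * c j + β * δ k j) → ⟦ R ⟧ (v +ₚ (β ·ₚ (gen R k -ₚ v)))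
towardsGenerator-∈ R {v} (c , _ , Σc≡1 , v≡) k β c′≥0 = c′ , c′≥0 , Σc′≡1 , v′≡
  where
  open ≡-Reasoning
  c′ : Fin (n R) → ℚ
  c′ j = (1ℚ - β) * c j + β * δ k j
  Σc′≡1 : sumFin c′ ≡ 1ℚ
  Σc′≡1 = begin
    sumFin c′                              ≡⟨ sumFin-linear (1ℚ - β) β c (δ k) ⟩
    (1ℚ - β) * sumFin c + β * sumFin (δ k) ≡⟨ cong₂ (λ x y → (1ℚ - β) * x + β * y) Σc≡1 (sumFin-δ k) ⟩
    (1ℚ - β) * 1ℚ + β * 1ℚ                 ≡⟨ affine β ⟩
    1ℚ                                     ∎
    where
    affine : ∀ β → (1ℚ - β) * 1ℚ + β * 1ℚ ≡ 1ℚ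
    affine = solve-∀ ℚ-ring
  v′≡ : ∀ i → v i + β * (gen R k i - v i) ≡ sumFin (λ j → c′ j * gen R j i)
  v′≡ i = begin
    v i + β * (gen R k i - v i)
      ≡⟨ interpolate β (v i) (gen R k i) ⟩
    (1ℚ - β) * v i + β * gen R k i
      ≡⟨ cong₂ (λ x y → (1ℚ - β) * x + β * y) (v≡ i) (sym (sumFin-δ* k (λ j → gen R j i))) ⟩
    (1ℚ - β) * sumFin (λ j → c j * gen R j i) + β * sumFin (λ j → δ k j * gen R j i)
      ≡⟨ sumFin-linear (1ℚ - β) β (λ j → c j * gen R j i) (λ j → δ k j * gen R j i) ⟨
    sumFin (λ j → (1ℚ - β) * (c j * gen R j i) + β * (δ k j * gen R j i))
      ≡⟨ sumFin-cong (λ j → distribute (1ℚ - β) β (c j) (δ k j) (gen R j i)) ⟩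
    sumFin (λ j → c′ j * gen R j i) ∎
    where
    interpolate : ∀ β v g → v + β * (g - v) ≡ (1ℚ - β) * v + β * g
    interpolate = solve-∀ ℚ-ring
    distribute : ∀ a b x y g → a * (x * g) + b * (y * g) ≡ (a * x + b * y) * g
    distribute = solve-∀ ℚ-ring

vertex-notMidpoint : ∀ {R : Polytope d} {v u : Point d} {β} → IsVertex R v → 0ℚ < β →
  ⟦ R ⟧ (v +ₚ (β ·ₚ u)) → ⟦ R ⟧ (v +ₚ ((- β) ·ₚ u)) → u ≈ₚ 0ₚ
vertex-notMidpoint {v = v} {u} {β} (_ , extreme) 0<β v+βu∈R v-βu∈R i =
  pos*q≡0⇒q≡0 0<β (identityʳ-unique (v i) (β * u i) (v+βu≈v i))
  where
  v+βu≈v : (v +ₚ (β ·ₚ u)) ≈ₚ v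
  v+βu≈v = extreme _ _ ½ v+βu∈R v-βu∈R (positive⁻¹ ½) ½<1 (λ i → midpoint (v i) β (u i))
    where
    midpoint : ∀ v β u → v ≡ ½ * (v + β * u) + (1ℚ - ½) * (v + (- β) * u)
    midpoint = solve-∀ ℚ-ring

towardsGenerator-weights-nonneg : ∀ {c : Fin m → ℚ} → (∀ j → 0ℚ ≤ c j) → sumFin c ≡ 1ℚ →
  ∀ k j → 0ℚ ≤ (1ℚ - c k) * c j + c k * δ k j
towardsGenerator-weights-nonneg {c = c} c≥0 Σc≡1 k j =
  +-mono-≤ (*-nonneg 0≤1-cₖ (c≥0 j)) (*-nonneg (c≥0 k) (δ-nonneg k j))
  where
  0≤1-cₖ : 0ℚ ≤ 1ℚ - c k
  0≤1-cₖ = p≤q⇒0≤q-p (subst (c k ≤_) Σc≡1 (term≤sumFin c c≥0 k))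

awayFromGenerator-weights-nonneg : ∀ {c : Fin m → ℚ} → (∀ j → 0ℚ ≤ c j) →
  ∀ k j → 0ℚ ≤ (1ℚ - (- c k)) * c j + (- c k) * δ k j
awayFromGenerator-weights-nonneg {c = c} c≥0 k j with k Fin.≟ j
... | yes refl = begin
  0ℚ                                       ≤⟨ *-nonneg (c≥0 k) (c≥0 k) ⟩
  c k * c k                                ≡⟨ atGenerator (c k) ⟩
  (1ℚ - (- c k)) * c k + (- c k) * 1ℚ      ≡⟨ cong (λ δₖₖ → (1ℚ - (- c k)) * c k + (- c k) * δₖₖ) (δ-diag k) ⟨
  (1ℚ - (- c k)) * c k + (- c k) * δ k k   ∎
  where
  open ≤-Reasoning
  atGenerator : ∀ x → x * x ≡ (1ℚ - (- x)) * x + (- x) * 1ℚ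
  atGenerator = solve-∀ ℚ-ring
... | no k≢j = begin
  0ℚ                                       ≤⟨ +-mono-≤ (c≥0 j) (*-nonneg (c≥0 k) (c≥0 j)) ⟩
  c j + c k * c j                          ≡⟨ elsewhere (c k) (c j) ⟩
  (1ℚ - (- c k)) * c j + (- c k) * 0ℚ      ≡⟨ cong (λ δₖⱼ → (1ℚ - (- c k)) * c j + (- c k) * δₖⱼ) (δ-offDiag k j k≢j) ⟨
  (1ℚ - (- c k)) * c j + (- c k) * δ k j   ∎
  where
  open ≤-Reasoning
  elsewhere : ∀ x y → y + x * y ≡ (1ℚ - (- x)) * y + (- x) * 0ℚ
  elsewhere = solve-∀ ℚ-ring

-- A generator gₖ carrying positive weight cₖ in v spans the segment v ± cₖ (gₖ - v) inside R,
-- so at a vertex it must coincide with v.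
vertex-isIntegral : ∀ (R : Polytope d) → IsLattice R → ∀ {v} → IsVertex R v → IsIntegral v
vertex-isIntegral R lattice {v} vertex@(v∈R@(c , c≥0 , Σc≡1 , _) , _) i =
  subst IsInteger (gₖ≈v i) (lattice k i)
  where
  k : Fin (n R)
  k = proj₁ (positive-weight c Σc≡1)
  gₖ≈v : gen R k ≈ₚ v
  gₖ≈v i = x∙y⁻¹≈ε⇒x≈y (gen R k i) (v i) (vertex-notMidpoint vertex (proj₂ (positive-weight c Σc≡1))
    (towardsGenerator-∈ R v∈R k (c k) (towardsGenerator-weights-nonneg c≥0 Σc≡1 k))
    (towardsGenerator-∈ R v∈R k (- c k) (awayFromGenerator-weights-nonneg c≥0 k)) i)

G⊆integralPoints : ∀ (R : Polytope d) → IsLattice R → G R ⊆′ ⟦ R ⟧ ∩ IsIntegral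
G⊆integralPoints R lattice x (x∈R , v , vertex , x-v∈ℤ) =
  x∈R , IsIntegral-resp-≈ₚ (λ i → split (x i) (v i))
          (IsIntegral-+ₚ (x -ₚ v) v x-v∈ℤ (vertex-isIntegral R lattice vertex))
  where
  split : ∀ x v → x ≡ (x - v) + v
  split = solve-∀ ℚ-ring

integralPoints⊆G : ∀ (R : Polytope d) → IsLattice R → ⟦ R ⟧ ∩ IsIntegral ⊆′ G R
integralPoints⊆G R lattice x (x∈R , x∈ℤ) =
  let w , w-isVertex , w∈ℤ = lattice-integralVertex R lattice x∈R
  in x∈R , w , w-isVertex , IsIntegral-diff x w x∈ℤ w∈ℤ

⊕-monoˡ : ∀ {A A′ C : PSet d} → A ⊆′ A′ → A ⊕ C ⊆′ A′ ⊕ C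
⊕-monoˡ A⊆A′ x (a , c , a∈A , c∈C , x≈a+c) = a , c , A⊆A′ a a∈A , c∈C , x≈a+c

infix 4 _⊑[_]_

_⊑[_]_ : PSet d → PSet d → PSet d → Set
A ⊑[ C ] B = A ⊕ C ⊆′ B ⊕ C

⊑-⊕ : ∀ {A A′ B B′ C : PSet d} → A ⊑[ C ] A′ → B ⊑[ C ] B′ → A ⊕ B ⊑[ C ] A′ ⊕ B′
⊑-⊕ A⊑A′ B⊑B′ x (q , p , (a , b , a∈A , b∈B , q≈a+b) , p∈C , x≈q+p)
  with A⊑A′ (a +ₚ p) (a , p , a∈A , p∈C , λ _ → refl)
... | a′ , p′ , a′∈A′ , p′∈C , a+p≈a′+p′
  with B⊑B′ (b +ₚ p′) (b , p′ , b∈B , p′∈C , λ _ → refl)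
... | b′ , p″ , b′∈B′ , p″∈C , b+p′≈b′+p″ =
  a′ +ₚ b′ , p″ , (a′ , b′ , a′∈A′ , b′∈B′ , λ _ → refl) , p″∈C , x≈a′+b′+p″
  where
  open ≡-Reasoning
  x≈a′+b′+p″ : x ≈ₚ ((a′ +ₚ b′) +ₚ p″)
  x≈a′+b′+p″ i = begin
    x i                       ≡⟨ x≈q+p i ⟩
    q i + p i                 ≡⟨ cong (_+ p i) (q≈a+b i) ⟩
    (a i + b i) + p i         ≡⟨ exchange (a i) (b i) (p i) ⟩
    (a i + p i) + b i         ≡⟨ cong (_+ b i) (a+p≈a′+p′ i) ⟩
    (a′ i + p′ i) + b i       ≡⟨ reassociate (a′ i) (p′ i) (b i) ⟩
    a′ i + (b i + p′ i)       ≡⟨ cong (a′ i +_) (b+p′≈b′+p″ i) ⟩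
    a′ i + (b′ i + p″ i)      ≡⟨ +-assoc (a′ i) (b′ i) (p″ i) ⟨
    (a′ i + b′ i) + p″ i      ∎
    where
    exchange : ∀ a b p → (a + b) + p ≡ (a + p) + b
    exchange = solve-∀ ℚ-ring
    reassociate : ∀ a p b → (a + p) + b ≡ a + (b + p)
    reassociate = solve-∀ ℚ-ring

⊑-MinkSum : ∀ {C : PSet d} {A B : Fin s → PSet d} → (∀ i → A i ⊑[ C ] B i) → MinkSum A ⊑[ C ] MinkSum B
⊑-MinkSum {s = zero}  A⊑B x x∈ = x∈
⊑-MinkSum {s = suc s} A⊑B = ⊑-⊕ (A⊑B zero) (⊑-MinkSum (A⊑B ∘ suc))

MinkSum-integral : ∀ (A : Fin s → PSet d) → MinkSum (λ i → A i ∩ IsIntegral) ⊆′ MinkSum A ∩ IsIntegral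
MinkSum-integral {s = zero}  A x x≈0 = x≈0 , IsIntegral-resp-≈ₚ x≈0 (λ _ → refl)
MinkSum-integral {s = suc s} A x (a , b , (a∈A , a∈ℤ) , b∈ΣA , x≈a+b)
  with MinkSum-integral (A ∘ suc) b b∈ΣA
... | b∈ΣA′ , b∈ℤ =
  (a , b , a∈A , b∈ΣA′ , x≈a+b) , IsIntegral-resp-≈ₚ x≈a+b (IsIntegral-+ₚ a b a∈ℤ b∈ℤ)

mainTheorem9 : (d s : ℕ) (P Q : Polytope d) (Qs : Fin s → Polytope d) →
    IsLattice Q → (∀ i → IsLattice (Qs i)) →
    (⟦ Q ⟧ ≐ MinkSum (λ i → ⟦ Qs i ⟧)) →
    (∀ i → ConvexNormal (Qs i) P) →
    ConvexNormal Q P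
mainTheorem9 d s P Q Qs latticeQ latticeQs (Q⊆ΣQs , ΣQs⊆Q) normal =
  Q⊑GQ , ⊕-monoˡ (λ _ → proj₁)
  where
  Qᵢ⊑Qᵢ∩ℤ : ∀ i → ⟦ Qs i ⟧ ⊑[ ⟦ P ⟧ ] ⟦ Qs i ⟧ ∩ IsIntegral
  Qᵢ⊑Qᵢ∩ℤ i x = ⊕-monoˡ (G⊆integralPoints (Qs i) (latticeQs i)) x ∘ proj₁ (normal i) x
  ΣQᵢ∩ℤ⊆GQ : MinkSum (λ i → ⟦ Qs i ⟧ ∩ IsIntegral) ⊆′ G Q
  ΣQᵢ∩ℤ⊆GQ x = integralPoints⊆G Q latticeQ x ∘ map₁ (ΣQs⊆Q x) ∘ MinkSum-integral (λ i → ⟦ Qs i ⟧) x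
  Q⊑GQ : ⟦ Q ⟧ ⊑[ ⟦ P ⟧ ] G Q
  Q⊑GQ x = ⊕-monoˡ ΣQᵢ∩ℤ⊆GQ x ∘ ⊑-MinkSum Qᵢ⊑Qᵢ∩ℤ x ∘ ⊕-monoˡ Q⊆ΣQs x
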